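{- For all $\sigma,\tau\in S_n$: if $\sigma\le\tau$ in the left weak order then $\sigma\le\tau$ in the left middle order, and if $\sigma\le\tau$ in the left middle order then $\sigma\le\tau$ in the Bruhat order. That is, the left middle order is a refinement of the left weak order and a coarsening of the Bruhat order.
   Context: The Lehmer code of $\sigma\in S_n$ is $(L_1,\dots,L_n)$ with $L_i=\#\{j>i:\sigma(j)<\sigma(i)\}$. The left middle order on $S_n$: $\sigma\le\tau$ iff $L_i(\sigma)\le L_i(\tau)$ for all $i$. The left weak order on $S_n$ is the partial order generated by $\sigma<s_i\sigma$ whenever $\ell(s_i\sigma)=\ell(\sigma)+1$, where $s_i=(i,i+1)$, $\ell$ is Coxeter length (number of inversions), and $s_i\sigma$ is the composition (interchanging the values $i,i+1$ in the one-line notation of $\sigma$). The Bruhat order is the usual Bruhat order on $S_n$. -}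

module Defs where

open import Data.Nat using (ℕ; suc; _≤_; _<_)
open import Data.Fin using (Fin; toℕ) renaming (_<_ to _<ᶠ_; _<?_ to _<ᶠ?_)
open import Data.Fin.Permutation using (Permutation′; _⟨$⟩ʳ_; transpose; _≈_)
open import Data.List using (List; length; filter; map; allFin)
open import Data.Nat.ListAction using (sum)
open import Data.Product using (Σ; ∃; ∃-syntax; _×_)
open import Relation.Nullary.Decidable using (_×-dec_)
open import Relation.Binary.PropositionalEquality using (_≡_)
open import Relation.Binary.Construct.Closure.ReflexiveTransitive using (Star)

-- S_n, elements acting on {0,…,n-1}; σ ⟨$⟩ʳ i is the value σ(i) (one-line notation)
Perm : ℕ → Set
Perm n = Permutation′ n

lehmer : ∀ {n} → Perm n → Fin n → ℕ
lehmer {n} σ i =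
  length (filter (λ j → (i <ᶠ? j) ×-dec ((σ ⟨$⟩ʳ j) <ᶠ? (σ ⟨$⟩ʳ i))) (allFin n))

-- Coxeter length = number of inversions = sum of the Lehmer code
len : ∀ {n} → Perm n → ℕ
len {n} σ = sum (map (lehmer σ) (allFin n))

MiddleLe : ∀ {n} → Perm n → Perm n → Set
MiddleLe {n} σ τ = ∀ (i : Fin n) → lehmer σ i ≤ lehmer τ i

WeakStep : ∀ {n} → Perm n → Perm n → Set
WeakStep {n} σ τ =
  Σ (Fin n) λ i → Σ (Fin n) λ j →
    (toℕ j ≡ suc (toℕ i)) ×
    (∀ x → τ ⟨$⟩ʳ x ≡ transpose i j ⟨$⟩ʳ (σ ⟨$⟩ʳ x)) ×
    (len τ ≡ suc (len σ))

-- left weak order: reflexive-transitive closure of WeakStep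
-- (permutations are identified when equal as functions)
WeakLe : ∀ {n} → Perm n → Perm n → Set
WeakLe {n} σ τ = ∃[ ρ ] (Star (WeakStep {n}) σ ρ × ρ ≈ τ)

BruhatStep : ∀ {n} → Perm n → Perm n → Set
BruhatStep {n} σ τ =
  Σ (Fin n) λ a → Σ (Fin n) λ b →
    (a <ᶠ b) ×
    (∀ x → τ ⟨$⟩ʳ x ≡ transpose a b ⟨$⟩ʳ (σ ⟨$⟩ʳ x)) ×
    (len σ < len τ)

BruhatLe : ∀ {n} → Perm n → Perm n → Set
BruhatLe {n} σ τ = ∃[ ρ ] (Star (BruhatStep {n}) σ ρ × ρ ≈ τ)

{-# OPTIONS --safe #-}
-- A covering step σ ⋖ s_a σ of the left weak order swaps the values a and a + 1, and since it
-- raises the length, a precedes a + 1 in σ. Every other pair of values keeps its relative order,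
-- so the inversions at each position only grow, and so does every Lehmer entry.
--
-- Conversely, let L(σ) ≤ L(τ) entrywise with L_i(σ) < L_i(τ). Then some j > i has σ(j) > σ(i);
-- let v = σ(i) and let w be the least value above v occurring to the right of i. Swapping the
-- values v and w is a Bruhat step which adds exactly one inversion at position i. Positions right
-- of i only carry values outside [v, w), whose relative order the swap preserves, and for k < i
-- the entry L_k = σ(k) - #{j < k : σ(j) < σ(k)} depends only on σ(0), …, σ(k), which did not
-- change. So L_i grows by one and every other entry stays. Iterating ends at a permutation with
-- the Lehmer code of τ, which is τ itself because the Lehmer code is injective.
module Submission where

open import Defs
open import Data.Bool using (if_then_else_)
open import Data.Nat using (ℕ; zero; suc; _+_; _≤_; _<_; z≤n; s≤s; s≤s⁻¹; _<?_)
open import Data.Nat.Properties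
  using (≤-refl; ≤-trans; ≤-antisym; ≤-reflexive; <⇒≤; <⇒≱; ≮⇒≥; ≰⇒>; <⇒≢; ≤-<-trans; n<1+n; 1+n≢n;
         m≤m+n; +-mono-≤; +-mono-<-≤; +-mono-≤-<; +-monoʳ-<; +-suc; +-cancelˡ-≡; +-0-commutativeMonoid;
         module ≤-Reasoning)
open import Data.Fin using (Fin; zero; suc; toℕ; _≟_)
  renaming (_<_ to _<ᶠ_; _≤_ to _≤ᶠ_; _<?_ to _<ᶠ?_)
import Data.Fin.Properties as Finₚ
open import Data.Fin.Induction using (<-wellFounded)
open import Data.Fin.Permutation
  using (Permutation′; _⟨$⟩ʳ_; _⟨$⟩ˡ_; transpose; _≈_; inverseˡ; inverseʳ; _∘ₚ_)
import Data.Fin.Permutation.Components as PC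
open import Data.List using (length; filter; tabulate)
open import Data.List.Properties using (map-tabulate)
open import Data.Nat.ListAction using (sum)
open import Data.Product using (∃-syntax; _×_; _,_; proj₁; proj₂)
open import Data.Sum using (_⊎_; inj₁; inj₂)
open import Function using (_∘_; id; flip)
open import Induction.WellFounded using (module All)
open import Level using (Level; 0ℓ)
open import Relation.Binary using (tri<; tri≈; tri>)
open import Relation.Binary.Construct.Closure.ReflexiveTransitive using (Star; ε; _◅_)
open import Relation.Binary.PropositionalEquality
open import Relation.Nullary using (Dec; does; yes; no; ¬_; ¬?; contradiction)
open import Relation.Nullary.Decidable using (_×-dec_; dec-true; dec-false)
open import Relation.Unary using (Pred; Decidable; _⊆_; _≐_; _∪_; ｛_｝; _∈_; _∉_)
open import Relation.Unary.Properties using (_∩?_; ∁?)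
import Algebra.Properties.CommutativeMonoid.Sum as CommutativeMonoidSum

open CommutativeMonoidSum +-0-commutativeMonoid using (∑-distrib-+; sum-permute; sum-cong-≗)
  renaming (sum to ∑)

private
  variable
    ℓ ℓ′ : Level
    n : ℕ
    A : Set

-- Counting over Fin n

indicator : {P : Set ℓ} → Dec P → ℕ
indicator p = if does p then 1 else 0

indicator-mono : {P : Set ℓ} {Q : Set ℓ′} (p : Dec P) (q : Dec Q) → (P → Q) → indicator p ≤ indicator q
indicator-mono (yes p) (yes _) _   = ≤-refl
indicator-mono (yes p) (no ¬q) P⇒Q = contradiction (P⇒Q p) ¬q
indicator-mono (no _)  _       _   = z≤n

indicator-split : {P : Set ℓ} {Q : Set ℓ′} (p : Dec P) (q : Dec Q) →
                  indicator p ≡ indicator (p ×-dec q) + indicator (p ×-dec ¬? q)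
indicator-split (yes _) (yes _) = refl
indicator-split (yes _) (no _)  = refl
indicator-split (no _)  (yes _) = refl
indicator-split (no _)  (no _)  = refl

∑-mono-≤ : (f g : Fin n → ℕ) → (∀ j → f j ≤ g j) → ∑ f ≤ ∑ g
∑-mono-≤ {zero}  f g f≤g = z≤n
∑-mono-≤ {suc n} f g f≤g = +-mono-≤ (f≤g zero) (∑-mono-≤ (f ∘ suc) (g ∘ suc) (f≤g ∘ suc))

∑-mono-< : (f g : Fin n → ℕ) → (∀ j → f j ≤ g j) → ∀ x → f x < g x → ∑ f < ∑ g
∑-mono-< f g f≤g zero    fx<gx = +-mono-<-≤ fx<gx (∑-mono-≤ (f ∘ suc) (g ∘ suc) (f≤g ∘ suc))
∑-mono-< f g f≤g (suc x) fx<gx = +-mono-≤-< (f≤g zero) (∑-mono-< (f ∘ suc) (g ∘ suc) (f≤g ∘ suc) x fx<gx)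

sum-tabulate : (f : Fin n → ℕ) → sum (tabulate f) ≡ ∑ f
sum-tabulate {zero}  f = refl
sum-tabulate {suc n} f = cong (f zero +_) (sum-tabulate (f ∘ suc))

count : {P : Pred (Fin n) ℓ} → Decidable P → ℕ
count P? = ∑ (indicator ∘ P?)

length-filter-tabulate : {P : Pred A ℓ} (P? : Decidable P) (f : Fin n → A) →
                         length (filter P? (tabulate f)) ≡ count (P? ∘ f)
length-filter-tabulate {n = zero}  P? f = refl
length-filter-tabulate {n = suc n} P? f with P? (f zero)
... | yes _ = cong suc (length-filter-tabulate P? (f ∘ suc))
... | no _  = length-filter-tabulate P? (f ∘ suc)

count-mono : {P Q : Pred (Fin n) ℓ} (P? : Decidable P) (Q? : Decidable Q) → P ⊆ Q → count P? ≤ count Q?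
count-mono P? Q? P⊆Q = ∑-mono-≤ _ _ (λ j → indicator-mono (P? j) (Q? j) P⊆Q)

count-mono-< : {P Q : Pred (Fin n) ℓ} (P? : Decidable P) (Q? : Decidable Q) →
               P ⊆ Q → ∀ {x} → x ∈ Q → x ∉ P → count P? < count Q?
count-mono-< P? Q? P⊆Q {x} x∈Q x∉P =
  ∑-mono-< _ _ (λ j → indicator-mono (P? j) (Q? j) P⊆Q) x (indicator-< (P? x) (Q? x) x∉P x∈Q)
  where
  indicator-< : {P : Set ℓ} {Q : Set ℓ} (p : Dec P) (q : Dec Q) → ¬ P → Q → indicator p < indicator q
  indicator-< (yes p) _      ¬p _ = contradiction p ¬p
  indicator-< (no _) (yes _) _  _ = s≤s z≤n
  indicator-< (no _) (no ¬q) _  q = contradiction q ¬q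

count-cong : {P Q : Pred (Fin n) ℓ} (P? : Decidable P) (Q? : Decidable Q) → P ≐ Q → count P? ≡ count Q?
count-cong P? Q? (P⊆Q , Q⊆P) = ≤-antisym (count-mono P? Q? P⊆Q) (count-mono Q? P? Q⊆P)

count-split : {P Q : Pred (Fin n) ℓ} (P? : Decidable P) (Q? : Decidable Q) →
              count P? ≡ count (P? ∩? Q?) + count (P? ∩? ∁? Q?)
count-split P? Q? = trans (sum-cong-≗ (λ j → indicator-split (P? j) (Q? j)))
                          (∑-distrib-+ (indicator ∘ (P? ∩? Q?)) (indicator ∘ (P? ∩? ∁? Q?)))

count-permute : {P : Pred (Fin n) ℓ} (P? : Decidable P) (π : Permutation′ n) →
                count P? ≡ count (P? ∘ (π ⟨$⟩ʳ_))
count-permute P? π = sum-permute (indicator ∘ P?) π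

count-none : {P : Pred (Fin n) ℓ} (P? : Decidable P) → (∀ j → j ∉ P) → count P? ≡ 0
count-none {zero}  P? ∉P = refl
count-none {suc n} P? ∉P with P? zero
... | yes p = contradiction p (∉P zero)
... | no _  = count-none (P? ∘ suc) (∉P ∘ suc)

count-< : (v : Fin n) → count (λ (x : Fin n) → x <ᶠ? v) ≡ toℕ v
count-< {suc n} zero    = count-none (λ (x : Fin (suc n)) → x <ᶠ? zero {n}) (λ _ ())
count-< {suc n} (suc v) = cong suc (count-< {n} v)

count-insert : {P Q : Pred (Fin n) ℓ} (P? : Decidable P) (Q? : Decidable Q) →
               ∀ {x} → x ∉ P → Q ≐ P ∪ ｛ x ｝ → count Q? ≡ suc (count P?)
count-insert {n = suc n} {P = P} {Q} P? Q? {zero} x∉P (Q⊆ , ⊆Q) with P? zero | Q? zero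
... | yes x∈P | _      = contradiction x∈P x∉P
... | no _    | no x∉Q = contradiction (⊆Q (inj₂ refl)) x∉Q
... | no _    | yes _  = cong suc (count-cong (Q? ∘ suc) (P? ∘ suc) (tail-⊆ , ⊆Q ∘ inj₁))
  where
  tail-⊆ : ∀ {j} → suc j ∈ Q → suc j ∈ P
  tail-⊆ j∈Q with Q⊆ j∈Q
  ... | inj₁ j∈P = j∈P
count-insert {n = suc n} {P = P} {Q} P? Q? {suc x} x∉P (Q⊆ , ⊆Q) = begin
  indicator (Q? zero) + count (Q? ∘ suc)
    ≡⟨ cong₂ _+_ head-≡ (count-insert (P? ∘ suc) (Q? ∘ suc) x∉P (tail-⊆ , tail-⊇)) ⟩
  indicator (P? zero) + suc (count (P? ∘ suc))  ≡⟨ +-suc (indicator (P? zero)) _ ⟩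
  suc (count P?)                                ∎
  where
  open ≡-Reasoning
  tail-⊆ : ∀ {j} → suc j ∈ Q → suc j ∈ P ⊎ x ≡ j
  tail-⊆ j∈Q with Q⊆ j∈Q
  ... | inj₁ j∈P  = inj₁ j∈P
  ... | inj₂ refl = inj₂ refl
  tail-⊇ : ∀ {j} → suc j ∈ P ⊎ x ≡ j → suc j ∈ Q
  tail-⊇ (inj₁ j∈P)  = ⊆Q (inj₁ j∈P)
  tail-⊇ (inj₂ refl) = ⊆Q (inj₂ refl)
  head-≡ : indicator (Q? zero) ≡ indicator (P? zero)
  head-≡ = ≤-antisym (indicator-mono (Q? zero) (P? zero) zero-⊆)
                     (indicator-mono (P? zero) (Q? zero) (⊆Q ∘ inj₁))
    where
    zero-⊆ : zero ∈ Q → zero ∈ P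
    zero-⊆ z∈Q with Q⊆ z∈Q
    ... | inj₁ z∈P = z∈P

-- Transpositions and the order of Fin n

[_,_⟩ : Fin n → Fin n → Pred (Fin n) 0ℓ
[ v , w ⟩ x = v ≤ᶠ x × x <ᶠ w

module _ (v w : Fin n) where

  private
    t : Fin n → Fin n
    t = PC.transpose v w

  transpose-matchˡ : t v ≡ w
  transpose-matchˡ rewrite dec-true (v ≟ v) refl = refl

  transpose-matchʳ : t w ≡ v
  transpose-matchʳ with w ≟ v
  ... | yes w≡v = w≡v
  ... | no  _   rewrite dec-true (w ≟ w) refl = refl

  transpose-other : ∀ {k} → k ≢ v → k ≢ w → t k ≡ k
  transpose-other {k} k≢v k≢w rewrite dec-false (k ≟ v) k≢v | dec-false (k ≟ w) k≢w = refl

  private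
    fixed : ∀ {k} → v ≢ k → w ≢ k → t k ≡ k
    fixed v≢k w≢k = transpose-other (v≢k ∘ sym) (w≢k ∘ sym)

  transpose-involutive : ∀ k → t (t k) ≡ k
  transpose-involutive k with v ≟ k | w ≟ k
  ... | yes refl | _        = trans (cong t transpose-matchˡ) transpose-matchʳ
  ... | no _     | yes refl = trans (cong t transpose-matchʳ) transpose-matchˡ
  ... | no v≢k   | no w≢k   = trans (cong t (fixed v≢k w≢k)) (fixed v≢k w≢k)

  -- The pairs x < y whose order (v w) reverses are those with x = v, y ≤ w or with v ≤ x, y = w.
  transpose-mono-< : v <ᶠ w → ∀ {x y} → x <ᶠ y → (x ≡ v → w <ᶠ y) → (y ≡ w → x <ᶠ v) → t x <ᶠ t y
  transpose-mono-< v<w {x} {y} x<y x≡v⇒w<y y≡w⇒x<v with v ≟ x | w ≟ x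
  ... | yes refl | _ = subst₂ _<ᶠ_ (sym transpose-matchˡ) (sym (fixed (Finₚ.<⇒≢ x<y) (Finₚ.<⇒≢ w<y))) w<y
    where w<y = x≡v⇒w<y refl
  ... | no _ | yes refl = subst₂ _<ᶠ_ (sym transpose-matchʳ) (sym (fixed (Finₚ.<⇒≢ v<y) (Finₚ.<⇒≢ x<y))) v<y
    where v<y = Finₚ.<-trans v<w x<y
  ... | no v≢x | no w≢x with v ≟ y | w ≟ y
  ...   | yes refl | _        = subst₂ _<ᶠ_ (sym (fixed v≢x w≢x)) (sym transpose-matchˡ) (Finₚ.<-trans x<y v<w)
  ...   | no _     | yes refl = subst₂ _<ᶠ_ (sym (fixed v≢x w≢x)) (sym transpose-matchʳ) (y≡w⇒x<v refl)
  ...   | no v≢y   | no w≢y   = subst₂ _<ᶠ_ (sym (fixed v≢x w≢x)) (sym (fixed v≢y w≢y)) x<y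

  transpose-adjacent-mono-< : toℕ w ≡ suc (toℕ v) → ∀ {x y} → x <ᶠ y → ¬ (x ≡ v × y ≡ w) → t x <ᶠ t y
  transpose-adjacent-mono-< w≡1+v {x} {y} x<y ¬vw = transpose-mono-< v<w x<y x≡v⇒w<y y≡w⇒x<v
    where
    v<w : v <ᶠ w
    v<w = subst (toℕ v <_) (sym w≡1+v) (n<1+n (toℕ v))
    x≡v⇒w<y : x ≡ v → w <ᶠ y
    x≡v⇒w<y refl = Finₚ.≤∧≢⇒< (subst (_≤ toℕ y) (sym w≡1+v) x<y) (λ w≡y → ¬vw (refl , sym w≡y))
    y≡w⇒x<v : y ≡ w → x <ᶠ v
    y≡w⇒x<v refl = Finₚ.≤∧≢⇒< (s≤s⁻¹ (subst (suc (toℕ x) ≤_) w≡1+v x<y)) (λ x≡v → ¬vw (x≡v , refl))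

  module _ (v<w : v <ᶠ w) {x y : Fin n} (x∉ : x ∉ [ v , w ⟩) (y∉ : y ∉ [ v , w ⟩) where

    transpose-mono-<-outside : x <ᶠ y → t x <ᶠ t y
    transpose-mono-<-outside x<y = transpose-mono-< v<w x<y x≡v⇒w<y y≡w⇒x<v
      where
      x≡v⇒w<y : x ≡ v → w <ᶠ y
      x≡v⇒w<y refl = contradiction (≤-refl , v<w) x∉
      y≡w⇒x<v : y ≡ w → x <ᶠ v
      y≡w⇒x<v refl = ≰⇒> (λ v≤x → x∉ (v≤x , x<y))

  transpose-cancel-<-outside : (v<w : v <ᶠ w) → ∀ {x y} → x ∉ [ v , w ⟩ → y ∉ [ v , w ⟩ →
                               t x <ᶠ t y → x <ᶠ y
  transpose-cancel-<-outside v<w {x} {y} x∉ y∉ tx<ty with Finₚ.<-cmp x y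
  ... | tri< x<y _ _ = x<y
  ... | tri≈ _ refl _ = contradiction refl (Finₚ.<⇒≢ tx<ty)
  ... | tri> _ _ y<x = contradiction (transpose-mono-<-outside v<w y∉ x∉ y<x) (Finₚ.<-asym tx<ty)

-- Lehmer codes

⟨$⟩ʳ-injective : (σ : Perm n) → ∀ {x y} → σ ⟨$⟩ʳ x ≡ σ ⟨$⟩ʳ y → x ≡ y
⟨$⟩ʳ-injective σ {x} {y} σx≡σy = begin
  x                      ≡⟨ inverseˡ σ ⟨
  σ ⟨$⟩ˡ (σ ⟨$⟩ʳ x)      ≡⟨ cong (σ ⟨$⟩ˡ_) σx≡σy ⟩
  σ ⟨$⟩ˡ (σ ⟨$⟩ʳ y)      ≡⟨ inverseˡ σ ⟩
  y                      ∎
  where open ≡-Reasoning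

Inversion : Perm n → Fin n → Pred (Fin n) 0ℓ
Inversion σ i j = i <ᶠ j × σ ⟨$⟩ʳ j <ᶠ σ ⟨$⟩ʳ i

inversion? : (σ : Perm n) (i : Fin n) → Decidable (Inversion σ i)
inversion? σ i j = (i <ᶠ? j) ×-dec (σ ⟨$⟩ʳ j <ᶠ? σ ⟨$⟩ʳ i)

lehmer≡count : (σ : Perm n) (i : Fin n) → lehmer σ i ≡ count (inversion? σ i)
lehmer≡count σ i = length-filter-tabulate (inversion? σ i) id

lehmer-mono : (σ τ : Perm n) {i k : Fin n} → Inversion σ i ⊆ Inversion τ k → lehmer σ i ≤ lehmer τ k
lehmer-mono σ τ {i} {k} σ⊆τ = begin
  lehmer σ i                 ≡⟨ lehmer≡count σ i ⟩
  count (inversion? σ i)     ≤⟨ count-mono (inversion? σ i) (inversion? τ k) σ⊆τ ⟩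
  count (inversion? τ k)     ≡⟨ lehmer≡count τ k ⟨
  lehmer τ k                 ∎
  where open ≤-Reasoning

lehmer-cong : (σ τ : Perm n) {i k : Fin n} → Inversion σ i ≐ Inversion τ k → lehmer σ i ≡ lehmer τ k
lehmer-cong σ τ (σ⊆τ , τ⊆σ) = ≤-antisym (lehmer-mono σ τ σ⊆τ) (lehmer-mono τ σ τ⊆σ)

len≡∑lehmer : (σ : Perm n) → len σ ≡ ∑ (lehmer σ)
len≡∑lehmer σ = trans (cong sum (map-tabulate id (lehmer σ))) (sum-tabulate (lehmer σ))

MiddleLe-refl : (σ : Perm n) → MiddleLe σ σ
MiddleLe-refl σ i = ≤-refl

MiddleLe-trans : (σ ρ τ : Perm n) → MiddleLe σ ρ → MiddleLe ρ τ → MiddleLe σ τ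
MiddleLe-trans σ ρ τ σ≤ρ ρ≤τ i = ≤-trans (σ≤ρ i) (ρ≤τ i)

≈⇒MiddleLe : (σ τ : Perm n) → σ ≈ τ → MiddleLe σ τ
≈⇒MiddleLe σ τ σ≈τ i = lehmer-mono σ τ λ (i<j , σj<σi) → i<j , subst₂ _<ᶠ_ (σ≈τ _) (σ≈τ i) σj<σi

len-mono : (σ τ : Perm n) → MiddleLe σ τ → len σ ≤ len τ
len-mono σ τ σ≤τ =
  subst₂ _≤_ (sym (len≡∑lehmer σ)) (sym (len≡∑lehmer τ)) (∑-mono-≤ (lehmer σ) (lehmer τ) σ≤τ)

len-mono-< : (σ τ : Perm n) → MiddleLe σ τ → ∀ i → lehmer σ i < lehmer τ i → len σ < len τ
len-mono-< σ τ σ≤τ i σi<τi =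
  subst₂ _<_ (sym (len≡∑lehmer σ)) (sym (len≡∑lehmer τ)) (∑-mono-< (lehmer σ) (lehmer τ) σ≤τ i σi<τi)

-- The left weak order

adjacentSwap⇒MiddleLe : (σ τ : Perm n) {a b p q : Fin n} → toℕ b ≡ suc (toℕ a) →
                        (∀ x → τ ⟨$⟩ʳ x ≡ PC.transpose a b (σ ⟨$⟩ʳ x)) →
                        σ ⟨$⟩ʳ p ≡ a → σ ⟨$⟩ʳ q ≡ b → p <ᶠ q → MiddleLe σ τ
adjacentSwap⇒MiddleLe σ τ {a} {b} {p} {q} b≡1+a τ≡tσ σp≡a σq≡b p<q k = lehmer-mono σ τ σ⊆τ
  where
  not-swapped : ∀ {j} → k <ᶠ j → ¬ (σ ⟨$⟩ʳ j ≡ a × σ ⟨$⟩ʳ k ≡ b)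
  not-swapped k<j (σj≡a , σk≡b) = Finₚ.<-asym p<q (subst₂ _<ᶠ_
    (⟨$⟩ʳ-injective σ (trans σk≡b (sym σq≡b))) (⟨$⟩ʳ-injective σ (trans σj≡a (sym σp≡a))) k<j)
  σ⊆τ : Inversion σ k ⊆ Inversion τ k
  σ⊆τ {j} (k<j , σj<σk) = k<j , subst₂ _<ᶠ_ (sym (τ≡tσ j)) (sym (τ≡tσ k))
    (transpose-adjacent-mono-< a b b≡1+a σj<σk (not-swapped k<j))

weakStep⇒MiddleLe : (σ τ : Perm n) → WeakStep σ τ → MiddleLe σ τ
weakStep⇒MiddleLe σ τ (a , b , b≡1+a , τ≡tσ , len-τ) with Finₚ.<-cmp (σ ⟨$⟩ˡ a) (σ ⟨$⟩ˡ b)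
... | tri< p<q _ _ = adjacentSwap⇒MiddleLe σ τ b≡1+a τ≡tσ (inverseʳ σ) (inverseʳ σ) p<q
... | tri≈ _ p≡q _ = contradiction (sym (trans (cong toℕ a≡b) b≡1+a)) 1+n≢n
  where
  a≡b : a ≡ b
  a≡b = trans (sym (inverseʳ σ)) (trans (cong (σ ⟨$⟩ʳ_) p≡q) (inverseʳ σ))
... | tri> _ _ q<p = contradiction (len-mono τ σ τ≤σ) (<⇒≱ (subst (len σ <_) (sym len-τ) (n<1+n (len σ))))
  where
  t = PC.transpose a b
  σ≡tτ : ∀ x → σ ⟨$⟩ʳ x ≡ t (τ ⟨$⟩ʳ x)
  σ≡tτ x = trans (sym (transpose-involutive a b (σ ⟨$⟩ʳ x))) (cong t (sym (τ≡tσ x)))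
  τ-at : ∀ {x c} → σ ⟨$⟩ʳ x ≡ c → τ ⟨$⟩ʳ x ≡ t c
  τ-at {x} σx≡c = trans (τ≡tσ x) (cong t σx≡c)
  τ≤σ : MiddleLe τ σ
  τ≤σ = adjacentSwap⇒MiddleLe τ σ b≡1+a σ≡tτ (trans (τ-at (inverseʳ σ)) (transpose-matchʳ a b))
          (trans (τ-at (inverseʳ σ)) (transpose-matchˡ a b)) q<p

weakStar⇒MiddleLe : {σ τ : Perm n} → Star WeakStep σ τ → MiddleLe σ τ
weakStar⇒MiddleLe {σ = σ} ε = MiddleLe-refl σ
weakStar⇒MiddleLe {σ = σ} {τ} (_◅_ {j = ρ} step steps) =
  MiddleLe-trans σ ρ τ (weakStep⇒MiddleLe σ ρ step) (weakStar⇒MiddleLe steps)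

weakLe⇒MiddleLe : (σ τ : Perm n) → WeakLe σ τ → MiddleLe σ τ
weakLe⇒MiddleLe σ τ (ρ , σ⋯ρ , ρ≈τ) = MiddleLe-trans σ ρ τ (weakStar⇒MiddleLe σ⋯ρ) (≈⇒MiddleLe ρ τ ρ≈τ)

-- Injectivity of the Lehmer code

Below : Perm n → Fin n → Pred (Fin n) 0ℓ
Below σ b j = σ ⟨$⟩ʳ j <ᶠ b

below? : (σ : Perm n) (b : Fin n) → Decidable (Below σ b)
below? σ b j = σ ⟨$⟩ʳ j <ᶠ? b

count-below : (σ : Perm n) (b : Fin n) → count (below? σ b) ≡ toℕ b
count-below {n} σ b = trans (sym (count-permute (λ (x : Fin n) → x <ᶠ? b) σ)) (count-< b)

before? : (i : Fin n) → Decidable (λ (j : Fin n) → j <ᶠ i)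
before? i j = j <ᶠ? i

suffixBelow : Perm n → Fin n → Fin n → ℕ
suffixBelow σ i b = count (below? σ b ∩? ∁? (before? i))

suffixBelow-agree : (σ τ : Perm n) {i : Fin n} → (∀ {j} → j <ᶠ i → σ ⟨$⟩ʳ j ≡ τ ⟨$⟩ʳ j) →
                    ∀ b → suffixBelow σ i b ≡ suffixBelow τ i b
suffixBelow-agree {n} σ τ {i} agree b = +-cancelˡ-≡ (prefix σ) _ _ (begin
  prefix σ + suffixBelow σ i b  ≡⟨ count-split (below? σ b) (before? i) ⟨
  count (below? σ b)            ≡⟨ count-below σ b ⟩
  toℕ b                         ≡⟨ count-below τ b ⟨
  count (below? τ b)            ≡⟨ count-split (below? τ b) (before? i) ⟩
  prefix τ + suffixBelow τ i b  ≡⟨ cong (_+ suffixBelow τ i b) prefix-agree ⟨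
  prefix σ + suffixBelow τ i b  ∎)
  where
  open ≡-Reasoning
  prefix : Perm n → ℕ
  prefix ρ = count (below? ρ b ∩? before? i)
  prefix-agree : prefix σ ≡ prefix τ
  prefix-agree = count-cong (below? σ b ∩? before? i) (below? τ b ∩? before? i)
    ((λ (σj<b , j<i) → subst (_<ᶠ b) (agree j<i) σj<b , j<i) ,
     (λ (τj<b , j<i) → subst (_<ᶠ b) (sym (agree j<i)) τj<b , j<i))

lehmer≡suffixBelow : (σ : Perm n) (i : Fin n) → lehmer σ i ≡ suffixBelow σ i (σ ⟨$⟩ʳ i)
lehmer≡suffixBelow σ i =
  trans (lehmer≡count σ i)
        (count-cong (inversion? σ i) (below? σ (σ ⟨$⟩ʳ i) ∩? ∁? (before? i))
                    ((λ (i<j , σj<σi) → σj<σi , Finₚ.<-asym i<j) , right-of-i))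
  where
  right-of-i : ∀ {j} → σ ⟨$⟩ʳ j <ᶠ σ ⟨$⟩ʳ i × ¬ j <ᶠ i → Inversion σ i j
  right-of-i {j} (σj<σi , j≮i) with Finₚ.<-cmp i j
  ... | tri< i<j _ _ = i<j , σj<σi
  ... | tri≈ _ refl _ = contradiction σj<σi (Finₚ.<-irrefl refl)
  ... | tri> _ _ j<i = contradiction j<i j≮i

lehmer-<-suffixBelow : (σ : Perm n) (i : Fin n) {b : Fin n} → σ ⟨$⟩ʳ i <ᶠ b →
                       lehmer σ i < suffixBelow σ i b
lehmer-<-suffixBelow σ i {b} σi<b = begin-strict
  lehmer σ i                       ≡⟨ lehmer≡suffixBelow σ i ⟩
  suffixBelow σ i (σ ⟨$⟩ʳ i)       <⟨ count-mono-< (below? σ (σ ⟨$⟩ʳ i) ∩? ∁? (before? i))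
                                                    (below? σ b ∩? ∁? (before? i))
                                                    (λ (σj<σi , j≮i) → Finₚ.<-trans σj<σi σi<b , j≮i)
                                                    (σi<b , Finₚ.<-irrefl refl) i∉ ⟩
  suffixBelow σ i b                ∎
  where
  open ≤-Reasoning
  i∉ : ¬ (σ ⟨$⟩ʳ i <ᶠ σ ⟨$⟩ʳ i × ¬ i <ᶠ i)
  i∉ (σi<σi , _) = Finₚ.<-irrefl refl σi<σi

lehmer-prefix : (σ τ : Perm n) {k : Fin n} → (∀ {j} → j ≤ᶠ k → σ ⟨$⟩ʳ j ≡ τ ⟨$⟩ʳ j) →
                lehmer σ k ≡ lehmer τ k
lehmer-prefix σ τ {k} agree = begin
  lehmer σ k                  ≡⟨ lehmer≡suffixBelow σ k ⟩
  suffixBelow σ k (σ ⟨$⟩ʳ k)  ≡⟨ suffixBelow-agree σ τ (agree ∘ <⇒≤) (σ ⟨$⟩ʳ k) ⟩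
  suffixBelow τ k (σ ⟨$⟩ʳ k)  ≡⟨ cong (suffixBelow τ k) (agree ≤-refl) ⟩
  suffixBelow τ k (τ ⟨$⟩ʳ k)  ≡⟨ lehmer≡suffixBelow τ k ⟨
  lehmer τ k                  ∎
  where open ≡-Reasoning

lehmer-<-at-first-difference : (σ τ : Perm n) {i : Fin n} → (∀ {j} → j <ᶠ i → σ ⟨$⟩ʳ j ≡ τ ⟨$⟩ʳ j) →
                               σ ⟨$⟩ʳ i <ᶠ τ ⟨$⟩ʳ i → lehmer σ i < lehmer τ i
lehmer-<-at-first-difference σ τ {i} agree σi<τi = begin-strict
  lehmer σ i                  <⟨ lehmer-<-suffixBelow σ i σi<τi ⟩
  suffixBelow σ i (τ ⟨$⟩ʳ i)  ≡⟨ suffixBelow-agree σ τ agree (τ ⟨$⟩ʳ i) ⟩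
  suffixBelow τ i (τ ⟨$⟩ʳ i)  ≡⟨ lehmer≡suffixBelow τ i ⟨
  lehmer τ i                  ∎
  where open ≤-Reasoning

lehmer-injective : (σ τ : Perm n) → (∀ i → lehmer σ i ≡ lehmer τ i) → σ ≈ τ
lehmer-injective {n} σ τ same = All.wfRec <-wellFounded 0ℓ (λ i → σ ⟨$⟩ʳ i ≡ τ ⟨$⟩ʳ i) agree-at
  where
  agree-at : ∀ i → (∀ {j} → j <ᶠ i → σ ⟨$⟩ʳ j ≡ τ ⟨$⟩ʳ j) → σ ⟨$⟩ʳ i ≡ τ ⟨$⟩ʳ i
  agree-at i agree with Finₚ.<-cmp (σ ⟨$⟩ʳ i) (τ ⟨$⟩ʳ i)
  ... | tri< σi<τi _ _ = contradiction (same i) (<⇒≢ (lehmer-<-at-first-difference σ τ agree σi<τi))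
  ... | tri≈ _ σi≡τi _ = σi≡τi
  ... | tri> _ _ τi<σi =
    contradiction (sym (same i)) (<⇒≢ (lehmer-<-at-first-difference τ σ (sym ∘ agree) τi<σi))

-- The Bruhat order

least : {P : Pred (Fin n) ℓ} → Decidable P → ∀ {x} → x ∈ P → ∃[ w ] (w ∈ P × ∀ {y} → y <ᶠ w → y ∉ P)
least {suc n} P? {x} x∈P with P? zero
... | yes 0∈P = zero , 0∈P , λ ()
least {suc n} P? {zero}  0∈P | no 0∉P = contradiction 0∈P 0∉P
least {suc n} P? {suc x} x∈P | no 0∉P with least (P? ∘ suc) x∈P
... | w , w∈P , below-w∉P = suc w , w∈P , λ { {zero} _ → 0∉P ; {suc y} y<w → below-w∉P (s≤s⁻¹ y<w) }

lehmer-<⇒ascent : (σ τ : Perm n) {i : Fin n} → lehmer σ i < lehmer τ i →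
                  ∃[ j ] (i <ᶠ j × σ ⟨$⟩ʳ i <ᶠ σ ⟨$⟩ʳ j)
lehmer-<⇒ascent {n} σ τ {i} σi<τi with Finₚ.any? (λ j → (i <ᶠ? j) ×-dec (σ ⟨$⟩ʳ i <ᶠ? σ ⟨$⟩ʳ j))
... | yes ascent   = ascent
... | no no-ascent = contradiction (lehmer-mono τ σ all-inversions) (<⇒≱ σi<τi)
  where
  all-inversions : Inversion τ i ⊆ Inversion σ i
  all-inversions {j} (i<j , _) with Finₚ.<-cmp (σ ⟨$⟩ʳ j) (σ ⟨$⟩ʳ i)
  ... | tri< σj<σi _ _ = i<j , σj<σi
  ... | tri≈ _ σj≡σi _ = contradiction (⟨$⟩ʳ-injective σ σj≡σi) (Finₚ.<⇒≢ i<j ∘ sym)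
  ... | tri> _ _ σi<σj = contradiction (j , i<j , σi<σj) no-ascent

module RaiseLehmer (σ : Perm n) {i j : Fin n} (i<j : i <ᶠ j) (σi<σj : σ ⟨$⟩ʳ i <ᶠ σ ⟨$⟩ʳ j) where

  v : Fin n
  v = σ ⟨$⟩ʳ i

  Candidate : Pred (Fin n) 0ℓ
  Candidate u = v <ᶠ u × i <ᶠ σ ⟨$⟩ˡ u

  private
    minimal-candidate : ∃[ w ] (w ∈ Candidate × ∀ {u} → u <ᶠ w → u ∉ Candidate)
    minimal-candidate = least (λ u → (v <ᶠ? u) ×-dec (i <ᶠ? σ ⟨$⟩ˡ u))
                              (σi<σj , subst (i <ᶠ_) (sym (inverseˡ σ)) i<j)

  w : Fin n
  w = proj₁ minimal-candidate

  v<w : v <ᶠ w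
  v<w = proj₁ (proj₁ (proj₂ minimal-candidate))

  q : Fin n
  q = σ ⟨$⟩ˡ w

  i<q : i <ᶠ q
  i<q = proj₂ (proj₁ (proj₂ minimal-candidate))

  σq≡w : σ ⟨$⟩ʳ q ≡ w
  σq≡w = inverseʳ σ

  gap : ∀ {x} → i <ᶠ x → σ ⟨$⟩ʳ x ∉ [ v , w ⟩
  gap {x} i<x (v≤σx , σx<w) with Finₚ.<-cmp v (σ ⟨$⟩ʳ x)
  ... | tri< v<σx _ _ = proj₂ (proj₂ minimal-candidate) σx<w (v<σx , subst (i <ᶠ_) (sym (inverseˡ σ)) i<x)
  ... | tri≈ _ v≡σx _ = Finₚ.<⇒≢ i<x (⟨$⟩ʳ-injective σ v≡σx)
  ... | tri> _ _ σx<v = <⇒≱ σx<v v≤σx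

  σ′ : Perm n
  σ′ = σ ∘ₚ transpose v w

  σ′≡tσ : ∀ x → σ′ ⟨$⟩ʳ x ≡ transpose v w ⟨$⟩ʳ (σ ⟨$⟩ʳ x)
  σ′≡tσ x = refl

  σ′-fixed : ∀ {x} → x ≢ i → x ≢ q → σ′ ⟨$⟩ʳ x ≡ σ ⟨$⟩ʳ x
  σ′-fixed x≢i x≢q =
    transpose-other v w (x≢i ∘ ⟨$⟩ʳ-injective σ) (x≢q ∘ ⟨$⟩ʳ-injective σ ∘ flip trans (sym σq≡w))

  σ′i≡w : σ′ ⟨$⟩ʳ i ≡ w
  σ′i≡w = transpose-matchˡ v w

  σ′q≡v : σ′ ⟨$⟩ʳ q ≡ v
  σ′q≡v = trans (cong (PC.transpose v w) σq≡w) (transpose-matchʳ v w)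

  lehmer-σ′-at-i : lehmer σ′ i ≡ suc (lehmer σ i)
  lehmer-σ′-at-i = begin
    lehmer σ′ i                   ≡⟨ lehmer≡count σ′ i ⟩
    count (inversion? σ′ i)
      ≡⟨ count-insert (inversion? σ i) (inversion? σ′ i) q∉ (σ′⊆σ∪q , σ∪q⊆σ′) ⟩
    suc (count (inversion? σ i))  ≡⟨ cong suc (lehmer≡count σ i) ⟨
    suc (lehmer σ i)              ∎
    where
    open ≡-Reasoning
    q∉ : q ∉ Inversion σ i
    q∉ (_ , σq<v) = Finₚ.<-asym v<w (subst (_<ᶠ v) σq≡w σq<v)
    σ′⊆σ∪q : Inversion σ′ i ⊆ (Inversion σ i ∪ ｛ q ｝)
    σ′⊆σ∪q {x} (i<x , σ′x<w) with q ≟ x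
    ... | yes q≡x = inj₂ q≡x
    ... | no  q≢x = inj₁ (i<x , ≰⇒> (λ v≤σx → gap i<x (v≤σx , σx<w)))
      where
      σx<w : σ ⟨$⟩ʳ x <ᶠ w
      σx<w = subst₂ _<ᶠ_ (σ′-fixed (Finₚ.<⇒≢ i<x ∘ sym) (q≢x ∘ sym)) σ′i≡w σ′x<w
    σ∪q⊆σ′ : (Inversion σ i ∪ ｛ q ｝) ⊆ Inversion σ′ i
    σ∪q⊆σ′ (inj₁ (i<x , σx<v)) =
      i<x , subst₂ _<ᶠ_ (sym (σ′-fixed (Finₚ.<⇒≢ i<x ∘ sym) x≢q)) (sym σ′i≡w) (Finₚ.<-trans σx<v v<w)
      where
      x≢q : _ ≢ q
      x≢q refl = Finₚ.<-asym v<w (subst (_<ᶠ v) σq≡w σx<v)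
    σ∪q⊆σ′ (inj₂ refl) = i<q , subst₂ _<ᶠ_ (sym σ′q≡v) (sym σ′i≡w) v<w

  lehmer-σ′-right : ∀ {k} → i <ᶠ k → lehmer σ′ k ≡ lehmer σ k
  lehmer-σ′-right {k} i<k = lehmer-cong σ′ σ
    ( (λ (k<x , σ′x<σ′k) → k<x , transpose-cancel-<-outside v w v<w (gap′ k<x) (gap i<k) σ′x<σ′k)
    , (λ (k<x , σx<σk)   → k<x , transpose-mono-<-outside v w v<w (gap′ k<x) (gap i<k) σx<σk))
    where
    gap′ : ∀ {x} → k <ᶠ x → σ ⟨$⟩ʳ x ∉ [ v , w ⟩
    gap′ k<x = gap (Finₚ.<-trans i<k k<x)

  lehmer-σ′-left : ∀ {k} → k <ᶠ i → lehmer σ′ k ≡ lehmer σ k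
  lehmer-σ′-left {k} k<i = lehmer-prefix σ′ σ λ x≤k →
    let x<i = ≤-<-trans x≤k k<i in σ′-fixed (Finₚ.<⇒≢ x<i) (Finₚ.<⇒≢ (Finₚ.<-trans x<i i<q))

  lehmer-σ′-elsewhere : ∀ {k} → k ≢ i → lehmer σ′ k ≡ lehmer σ k
  lehmer-σ′-elsewhere {k} k≢i with Finₚ.<-cmp k i
  ... | tri< k<i _ _ = lehmer-σ′-left k<i
  ... | tri≈ _ k≡i _ = contradiction k≡i k≢i
  ... | tri> _ _ i<k = lehmer-σ′-right i<k

MiddleLe-<⇒BruhatStep : (σ τ : Perm n) {i : Fin n} → MiddleLe σ τ → lehmer σ i < lehmer τ i →
                        ∃[ σ′ ] (BruhatStep σ σ′ × MiddleLe σ′ τ)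
MiddleLe-<⇒BruhatStep σ τ {i} σ≤τ σi<τi with lehmer-<⇒ascent σ τ σi<τi
... | j , i<j , σi<σj = σ′ , (v , w , v<w , σ′≡tσ , len-mono-< σ σ′ σ≤σ′ i σi<σ′i) , σ′≤τ
  where
  open RaiseLehmer σ i<j σi<σj
  σi<σ′i : lehmer σ i < lehmer σ′ i
  σi<σ′i = subst (lehmer σ i <_) (sym lehmer-σ′-at-i) (n<1+n (lehmer σ i))
  σ≤σ′ : MiddleLe σ σ′
  σ≤σ′ k with k ≟ i
  ... | yes refl = <⇒≤ σi<σ′i
  ... | no  k≢i  = ≤-reflexive (sym (lehmer-σ′-elsewhere k≢i))
  σ′≤τ : MiddleLe σ′ τ
  σ′≤τ k with k ≟ i
  ... | yes refl = subst (_≤ lehmer τ i) (sym lehmer-σ′-at-i) σi<τi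
  ... | no  k≢i  = subst (_≤ lehmer τ k) (sym (lehmer-σ′-elsewhere k≢i)) (σ≤τ k)

MiddleLe⇒BruhatLe-within : ∀ m (σ τ : Perm n) → len τ ≤ m + len σ → MiddleLe σ τ → BruhatLe σ τ
MiddleLe⇒BruhatLe-within m σ τ bound σ≤τ with Finₚ.any? (λ i → lehmer σ i <? lehmer τ i)
... | no  none =
  σ , ε , lehmer-injective σ τ (λ i → ≤-antisym (σ≤τ i) (≮⇒≥ (λ σi<τi → none (i , σi<τi))))
... | yes (i , σi<τi) with m | MiddleLe-<⇒BruhatStep σ τ σ≤τ σi<τi
...   | zero  | _ = contradiction bound (<⇒≱ (len-mono-< σ τ σ≤τ i σi<τi))
...   | suc m | σ′ , step@(_ , _ , _ , _ , len<) , σ′≤τ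
        with MiddleLe⇒BruhatLe-within m σ′ τ (≤-trans bound (+-monoʳ-< m len<)) σ′≤τ
...     | ρ , σ′⋯ρ , ρ≈τ = ρ , step ◅ σ′⋯ρ , ρ≈τ

MiddleLe⇒BruhatLe : (σ τ : Perm n) → MiddleLe σ τ → BruhatLe σ τ
MiddleLe⇒BruhatLe σ τ = MiddleLe⇒BruhatLe-within (len τ) σ τ (m≤m+n (len τ) (len σ))

corollary1 : ∀ (n : ℕ) (σ τ : Perm n) →
    (WeakLe σ τ → MiddleLe σ τ) × (MiddleLe σ τ → BruhatLe σ τ)
corollary1 n σ τ = weakLe⇒MiddleLe σ τ , MiddleLe⇒BruhatLe σ τ
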